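{- Let $n\ge2$, $N=p_1\cdots p_n$ a product of distinct primes, and $i\ne j$ in $[n]$. Then modulo $x^N-1$, $$P_N(x)\equiv\frac{1-x^{\langle p_j^{ -1}\rangle_{p_i}N_i}}{1-x^{N_i}}P_{N_i}(x^{p_i})\prod_{k\ne i,j}(1-x^{N_{ik}})+x^{\langle p_j^{ -1}\rangle_{p_i}N_i}\cdot\frac{x^N-x^{\langle p_i^{ -1}\rangle_{p_j}N_j}}{1-x^{N_j}}P_{N_j}(x^{p_j})\prod_{k\ne i,j}(1-x^{N_{jk}}).$$
   Context: For a squarefree $M=q_1\cdots q_m$ ($m\ge1$ distinct primes) write $M_{i_1\cdots i_r}=M/(q_{i_1}\cdots q_{i_r})$ and $P_M(x)=\frac{(1-x^M)\prod_{1\le a<b\le m}(1-x^{M_{ab}})}{\prod_{a=1}^m(1-x^{M_a})}$ (a polynomial; empty products are $1$). In particular $N_i=N/p_i$, $N_{ik}=N/(p_ip_k)$, and $P_{N_i}$ is this polynomial for the product of the primes $p_k$, $k\ne i$. For a rational $c=a/b$ with $b$ coprime to $m$, $\langle c\rangle_m$ is the smallest nonnegative integer $k$ with $kb\equiv a\pmod m$. -}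

module Defs where

open import Data.Nat as ℕ using (ℕ; zero; suc; _<_; _<ᵇ_)
open import Data.Integer as ℤ using (ℤ; +_)
open import Data.Integer.Divisibility as ℤD using ()
open import Data.List.Base using (List; []; _∷_; replicate; _++_; map; foldr; allFin)
open import Data.Fin using (Fin; toℕ) renaming (_≟_ to _≟ᶠ_)
open import Data.Bool using (if_then_else_; _∨_)
open import Data.Product using (Σ; _×_)
open import Relation.Nullary using (¬_)
open import Relation.Nullary.Decidable using (⌊_⌋)
open import Relation.Binary.PropositionalEquality using (_≡_)

-- Integer polynomials as coefficient lists (constant term first).
Poly : Set
Poly = List ℤ

infixl 6 _+ₚ_ _-ₚ_
infixl 7 _*ₚ_

_+ₚ_ : Poly → Poly → Poly
[] +ₚ q = q
(a ∷ p) +ₚ [] = a ∷ p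
(a ∷ p) +ₚ (b ∷ q) = (a ℤ.+ b) ∷ (p +ₚ q)

-ₚ_ : Poly → Poly
-ₚ_ = map (λ a → ℤ.- a)

_-ₚ_ : Poly → Poly → Poly
p -ₚ q = p +ₚ (-ₚ q)

_*ₚ_ : Poly → Poly → Poly
[] *ₚ q = []
(a ∷ p) *ₚ q = map (a ℤ.*_) q +ₚ (+ 0 ∷ (p *ₚ q))

1ₚ : Poly
1ₚ = + 1 ∷ []

X^_ : ℕ → Poly
X^ k = replicate k (+ 0) ++ 1ₚ

subX^ : ℕ → Poly → Poly
subX^ d [] = []
subX^ d (a ∷ f) = (a ∷ []) +ₚ (replicate d (+ 0) ++ subX^ d f)

coeff : Poly → ℕ → ℤ
coeff [] k = + 0
coeff (a ∷ p) zero = a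
coeff (a ∷ p) (suc k) = coeff p k

-- equality of polynomials (coefficientwise; insensitive to trailing zeros)
infix 4 _≈ₚ_
_≈ₚ_ : Poly → Poly → Set
p ≈ₚ q = ∀ k → coeff p k ≡ coeff q k

CongModXN-1 : ℕ → Poly → Poly → Set
CongModXN-1 N f g = Σ Poly λ h → f ≈ₚ g +ₚ h *ₚ (X^ N -ₚ 1ₚ)

∏ₚ : ∀ {m} → (Fin m → Poly) → Poly
∏ₚ {m} f = foldr (λ a acc → f a *ₚ acc) 1ₚ (allFin m)

∏ℕ : ∀ {m} → (Fin m → ℕ) → ℕ
∏ℕ {m} f = foldr (λ a acc → f a ℕ.* acc) 1 (allFin m)

-- For M = q₁⋯q_m (q a family of distinct primes):
-- M, M_a = M / q_a, M_ab = M / (q_a q_b)  (as products over the complementary indices)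
Mof : ∀ {m} → (Fin m → ℕ) → ℕ
Mof q = ∏ℕ q

M₁ : ∀ {m} → (Fin m → ℕ) → Fin m → ℕ
M₁ q a = ∏ℕ (λ k → if ⌊ k ≟ᶠ a ⌋ then 1 else q k)

M₂ : ∀ {m} → (Fin m → ℕ) → Fin m → Fin m → ℕ
M₂ q a b = ∏ℕ (λ k → if ⌊ k ≟ᶠ a ⌋ ∨ ⌊ k ≟ᶠ b ⌋ then 1 else q k)

numP : ∀ {m} → (Fin m → ℕ) → Poly
numP q = (1ₚ -ₚ X^ (Mof q)) *ₚ
  ∏ₚ (λ a → ∏ₚ (λ b → if toℕ a <ᵇ toℕ b then 1ₚ -ₚ X^ (M₂ q a b) else 1ₚ))

denP : ∀ {m} → (Fin m → ℕ) → Poly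
denP q = ∏ₚ (λ a → 1ₚ -ₚ X^ (M₁ q a))

-- Q is the polynomial P_M (the exact quotient numP / denP)
IsP : ∀ {m} → (Fin m → ℕ) → Poly → Set
IsP q Q = Q *ₚ denP q ≈ₚ numP q

CongMod : ℕ → ℕ → ℕ → Set
CongMod m x y = (+ m) ℤD.∣ (+ x ℤ.- + y)

IsLeastSol : (m a b e : ℕ) → Set
IsLeastSol m a b e = CongMod m (e ℕ.* b) a × (∀ k → k < e → ¬ CongMod m (k ℕ.* b) a)

-- Write N = pᵢ pⱼ L with L = N_ij, and let D = ∏_a (1 - x^{N_a}) and E = (1 - x^N) F,
-- F = ∏_{a<b} (1 - x^{N_ab}), be the denominator and numerator of P_N. Splitting the index i
-- off every product gives D = (1 - x^{N_i}) D_{N_i}(x^{p_i}) and F = F_{N_i}(x^{p_i}) (1 - x^L) Π_i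
-- with Π_i = ∏_{k≠i,j} (1 - x^{N_ik}), hence D (1 - x^L) P_{N_i}(x^{p_i}) Π_i = (1 - x^{N_i}) E,
-- and symmetrically for j. So D (1 - x^L) times the right-hand side, corrected by
-- h (x^N - 1) with h = P_{N_j}(x^{p_j}) Π_j x^L (1 + x^{N_j} + … + x^{(c-1) N_j}), equals
-- E ((1 - a) + a (x^N - b) + x^L (1 - x^{c N_j}) (x^N - 1)), where a = x^{⟨p_j⁻¹⟩ N_i}, b = x^{⟨p_i⁻¹⟩ N_j}.
-- Minimality of the inverses forces ⟨p_j⁻¹⟩ p_j + ⟨p_i⁻¹⟩ p_i = 1 + p_i p_j, and ⟨p_j⁻¹⟩ p_j = 1 + c p_i;
-- thus a b = x^{L+N} and a = x^{L + c N_j}, and the bracket collapses to 1 - x^L. Since D (1 - x^L)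
-- has constant term 1, it can be cancelled in ℤ[x].

module Submission where

open import Defs
open import Data.Nat using (ℕ; suc; _≤_; _*_)
open import Data.Nat.Primality using (Prime)
open import Data.Fin using (Fin) renaming (_≟_ to _≟ᶠ_)
open import Data.Vec.Functional using (removeAt)
open import Data.Bool using (if_then_else_; _∨_)
open import Function.Definitions using (Injective)
open import Relation.Nullary.Decidable using (⌊_⌋)
open import Relation.Binary.PropositionalEquality using (_≡_; _≢_)

open import Algebra.Bundles using (CommutativeRing; CommutativeMonoid)
import Algebra.Properties.CommutativeMonoid.Sum as CommutativeMonoidProduct
open import Data.Bool using (Bool; true; false)
open import Data.Bool.Properties using (∨-comm; ∨-identityʳ; ∨-zeroʳ)
open import Data.Empty using (⊥-elim)
open import Data.Fin using (zero; suc; punchIn; toℕ)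
open import Data.Fin.Properties using (punchIn-injective; punchInᵢ≢i; toℕ-injective)
open import Data.Integer as ℤ using (ℤ; +_; +0)
import Data.Integer.Properties as ℤP
open import Data.List.Base as List using ([]; _∷_; map; replicate; _++_; tabulate)
open import Data.Maybe.Base as Maybe using (Maybe; just; nothing)
open import Data.Nat as ℕ using (zero; _+_; _∸_; _%_; _/_; _<_; _<?_; _<ᵇ_)
import Data.Nat.Properties as ℕP
open import Data.Nat.DivMod using (m≡m%n+[m/n]*n; [m+kn]%n≡m%n; m<n⇒m%n≡m)
open import Data.Nat.Divisibility using (_∣_; divides; ∣1⇒≡1)
open import Data.Nat.Primality using (euclidsLemma; prime⇒irreducible; prime⇒nonTrivial)
open import Data.Nat.Tactic.RingSolver using (solve-∀)
open import Data.Product using (_×_; _,_; proj₁; proj₂; ∃-syntax)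
open import Data.Sum using (inj₁; inj₂)
open import Function.Base using (_∘_)
open import Level using (0ℓ)
open import Relation.Nullary using (Dec; ¬_; yes; no; contradiction)
open import Relation.Nullary.Decidable using (isYes≗does; dec-true; dec-false)
open import Relation.Binary.PropositionalEquality
  using (refl; sym; trans; cong; cong₂; subst; module ≡-Reasoning)
open import Tactic.RingSolver.Core.AlmostCommutativeRing using (fromCommutativeRing)
import Relation.Binary.Reasoning.Setoid

-- The wrapper makes the relation injective in both arguments, which the ring solver relies on.
infix 4 _≋_
record _≋_ (p q : Poly) : Set where
  constructor mk≋
  field coeff-≡ : p ≈ₚ q
open _≋_ public

≋-refl : ∀ {p} → p ≋ p
≋-refl = mk≋ λ _ → refl

≋-sym : ∀ {p q} → p ≋ q → q ≋ p
≋-sym (mk≋ e) = mk≋ λ k → sym (e k)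

≋-trans : ∀ {p q r} → p ≋ q → q ≋ r → p ≋ r
≋-trans (mk≋ e) (mk≋ f) = mk≋ λ k → trans (e k) (f k)

≡⇒≋ : ∀ {p q} → p ≡ q → p ≋ q
≡⇒≋ refl = ≋-refl

∷-cong : ∀ {a b p q} → a ≡ b → p ≋ q → a ∷ p ≋ b ∷ q
∷-cong a≡b (mk≋ e) = mk≋ λ { zero → a≡b ; (suc k) → e k }

∷-injectiveʳ : ∀ {a b p q} → a ∷ p ≋ b ∷ q → p ≋ q
∷-injectiveʳ (mk≋ e) = mk≋ λ k → e (suc k)

0∷[]≋[] : +0 ∷ [] ≋ []
0∷[]≋[] = mk≋ λ { zero → refl ; (suc k) → refl }

scale : ℤ → Poly → Poly
scale a = map (a ℤ.*_)

coeff-+ₚ : ∀ p q k → coeff (p +ₚ q) k ≡ coeff p k ℤ.+ coeff q k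
coeff-+ₚ []      q       k       = sym (ℤP.+-identityˡ _)
coeff-+ₚ (a ∷ p) []      k       = sym (ℤP.+-identityʳ _)
coeff-+ₚ (a ∷ p) (b ∷ q) zero    = refl
coeff-+ₚ (a ∷ p) (b ∷ q) (suc k) = coeff-+ₚ p q k

coeff-neg : ∀ p k → coeff (-ₚ p) k ≡ ℤ.- coeff p k
coeff-neg []      k       = refl
coeff-neg (a ∷ p) zero    = refl
coeff-neg (a ∷ p) (suc k) = coeff-neg p k

coeff-scale : ∀ a p k → coeff (scale a p) k ≡ a ℤ.* coeff p k
coeff-scale a []      k       = sym (ℤP.*-zeroʳ a)
coeff-scale a (b ∷ p) zero    = refl
coeff-scale a (b ∷ p) (suc k) = coeff-scale a p k

+ₚ-cong : ∀ {p p′ q q′} → p ≋ p′ → q ≋ q′ → p +ₚ q ≋ p′ +ₚ q′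
+ₚ-cong {p} {p′} {q} {q′} (mk≋ e) (mk≋ f) = mk≋ λ k → begin
  coeff (p +ₚ q) k          ≡⟨ coeff-+ₚ p q k ⟩
  coeff p k ℤ.+ coeff q k   ≡⟨ cong₂ ℤ._+_ (e k) (f k) ⟩
  coeff p′ k ℤ.+ coeff q′ k ≡⟨ coeff-+ₚ p′ q′ k ⟨
  coeff (p′ +ₚ q′) k        ∎
  where open ≡-Reasoning

+ₚ-assoc : ∀ p q r → (p +ₚ q) +ₚ r ≋ p +ₚ (q +ₚ r)
+ₚ-assoc p q r = mk≋ λ k → begin
  coeff ((p +ₚ q) +ₚ r) k                    ≡⟨ coeff-+ₚ (p +ₚ q) r k ⟩
  coeff (p +ₚ q) k ℤ.+ coeff r k             ≡⟨ cong (ℤ._+ coeff r k) (coeff-+ₚ p q k) ⟩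
  (coeff p k ℤ.+ coeff q k) ℤ.+ coeff r k    ≡⟨ ℤP.+-assoc (coeff p k) _ _ ⟩
  coeff p k ℤ.+ (coeff q k ℤ.+ coeff r k)    ≡⟨ cong₂ ℤ._+_ (refl {x = coeff p k}) (coeff-+ₚ q r k) ⟨
  coeff p k ℤ.+ coeff (q +ₚ r) k             ≡⟨ coeff-+ₚ p (q +ₚ r) k ⟨
  coeff (p +ₚ (q +ₚ r)) k                    ∎
  where open ≡-Reasoning

+ₚ-comm : ∀ p q → p +ₚ q ≋ q +ₚ p
+ₚ-comm p q = mk≋ λ k →
  trans (coeff-+ₚ p q k) (trans (ℤP.+-comm (coeff p k) _) (sym (coeff-+ₚ q p k)))

+ₚ-identityʳ : ∀ p → p +ₚ [] ≋ p
+ₚ-identityʳ p = mk≋ λ k → trans (coeff-+ₚ p [] k) (ℤP.+-identityʳ _)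

-ₚ‿cong : ∀ {p q} → p ≋ q → -ₚ p ≋ -ₚ q
-ₚ‿cong {p} {q} (mk≋ e) = mk≋ λ k →
  trans (coeff-neg p k) (trans (cong ℤ.-_ (e k)) (sym (coeff-neg q k)))

-ₚ‿inverseʳ : ∀ p → p +ₚ (-ₚ p) ≋ []
-ₚ‿inverseʳ p = mk≋ λ k →
  trans (coeff-+ₚ p (-ₚ p) k)
        (trans (cong₂ ℤ._+_ (refl {x = coeff p k}) (coeff-neg p k)) (ℤP.+-inverseʳ (coeff p k)))

-ₚ‿inverseˡ : ∀ p → (-ₚ p) +ₚ p ≋ []
-ₚ‿inverseˡ p = ≋-trans (+ₚ-comm (-ₚ p) p) (-ₚ‿inverseʳ p)

scale-cong : ∀ a {p q} → p ≋ q → scale a p ≋ scale a q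
scale-cong a {p} {q} (mk≋ e) = mk≋ λ k →
  trans (coeff-scale a p k) (trans (cong (a ℤ.*_) (e k)) (sym (coeff-scale a q k)))

scale-+ₚ : ∀ a p q → scale a (p +ₚ q) ≋ scale a p +ₚ scale a q
scale-+ₚ a p q = mk≋ λ k → begin
  coeff (scale a (p +ₚ q)) k                      ≡⟨ coeff-scale a (p +ₚ q) k ⟩
  a ℤ.* coeff (p +ₚ q) k                          ≡⟨ cong (a ℤ.*_) (coeff-+ₚ p q k) ⟩
  a ℤ.* (coeff p k ℤ.+ coeff q k)                 ≡⟨ ℤP.*-distribˡ-+ a (coeff p k) _ ⟩
  a ℤ.* coeff p k ℤ.+ a ℤ.* coeff q k             ≡⟨ cong₂ ℤ._+_ (coeff-scale a p k) (coeff-scale a q k) ⟨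
  coeff (scale a p) k ℤ.+ coeff (scale a q) k     ≡⟨ coeff-+ₚ (scale a p) (scale a q) k ⟨
  coeff (scale a p +ₚ scale a q) k                ∎
  where open ≡-Reasoning

scale-scale : ∀ a b p → scale a (scale b p) ≋ scale (a ℤ.* b) p
scale-scale a b p = mk≋ λ k → begin
  coeff (scale a (scale b p)) k  ≡⟨ coeff-scale a (scale b p) k ⟩
  a ℤ.* coeff (scale b p) k      ≡⟨ cong (a ℤ.*_) (coeff-scale b p k) ⟩
  a ℤ.* (b ℤ.* coeff p k)        ≡⟨ ℤP.*-assoc a b _ ⟨
  a ℤ.* b ℤ.* coeff p k          ≡⟨ coeff-scale (a ℤ.* b) p k ⟨
  coeff (scale (a ℤ.* b) p) k    ∎
  where open ≡-Reasoning

scale-zero : ∀ p → scale +0 p ≋ []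
scale-zero p = mk≋ λ k → trans (coeff-scale +0 p k) (ℤP.*-zeroˡ (coeff p k))

*ₚ-congˡ : ∀ p {q q′} → q ≋ q′ → p *ₚ q ≋ p *ₚ q′
*ₚ-congˡ []      q≋q′ = ≋-refl
*ₚ-congˡ (a ∷ p) q≋q′ = +ₚ-cong (scale-cong a q≋q′) (∷-cong refl (*ₚ-congˡ p q≋q′))

*ₚ-zeroʳ : ∀ p → p *ₚ [] ≋ []
*ₚ-zeroʳ []      = ≋-refl
*ₚ-zeroʳ (a ∷ p) = mk≋ λ { zero → refl ; (suc k) → coeff-≡ (*ₚ-zeroʳ p) k }

+ₚ-swapˡ : ∀ p q r → p +ₚ (q +ₚ r) ≋ q +ₚ (p +ₚ r)
+ₚ-swapˡ p q r = ≋-trans (≋-sym (+ₚ-assoc p q r))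
  (≋-trans (+ₚ-cong (+ₚ-comm p q) ≋-refl) (+ₚ-assoc q p r))

*ₚ-∷ʳ : ∀ p b q → p *ₚ (b ∷ q) ≋ scale b p +ₚ (+0 ∷ (p *ₚ q))
*ₚ-∷ʳ []      b q = mk≋ λ { zero → refl ; (suc k) → refl }
*ₚ-∷ʳ (a ∷ p) b q = ∷-cong (cong (ℤ._+ +0) (ℤP.*-comm a b))
  (≋-trans (+ₚ-cong (≋-refl {scale a q}) (*ₚ-∷ʳ p b q)) (+ₚ-swapˡ (scale a q) (scale b p) (+0 ∷ (p *ₚ q))))

*ₚ-comm : ∀ p q → p *ₚ q ≋ q *ₚ p
*ₚ-comm []      q = ≋-sym (*ₚ-zeroʳ q)
*ₚ-comm (a ∷ p) q =
  ≋-trans (+ₚ-cong (≋-refl {scale a q}) (∷-cong refl (*ₚ-comm p q))) (≋-sym (*ₚ-∷ʳ q a p))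

*ₚ-congʳ : ∀ {p p′} q → p ≋ p′ → p *ₚ q ≋ p′ *ₚ q
*ₚ-congʳ {p} {p′} q p≋p′ =
  ≋-trans (*ₚ-comm p q) (≋-trans (*ₚ-congˡ q p≋p′) (*ₚ-comm q p′))

*ₚ-cong : ∀ {p p′ q q′} → p ≋ p′ → q ≋ q′ → p *ₚ q ≋ p′ *ₚ q′
*ₚ-cong {p′ = p′} {q} p≋p′ q≋q′ = ≋-trans (*ₚ-congʳ q p≋p′) (*ₚ-congˡ p′ q≋q′)

+ₚ-interchange : ∀ p q r s → (p +ₚ q) +ₚ (r +ₚ s) ≋ (p +ₚ r) +ₚ (q +ₚ s)
+ₚ-interchange p q r s = ≋-trans (+ₚ-assoc p q (r +ₚ s))
  (≋-trans (+ₚ-cong (≋-refl {p}) (+ₚ-swapˡ q r s)) (≋-sym (+ₚ-assoc p r (q +ₚ s))))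

*ₚ-distribˡ : ∀ p q r → p *ₚ (q +ₚ r) ≋ p *ₚ q +ₚ p *ₚ r
*ₚ-distribˡ []      q r = ≋-refl
*ₚ-distribˡ (a ∷ p) q r = ≋-trans
  (+ₚ-cong (scale-+ₚ a q r) (∷-cong refl (*ₚ-distribˡ p q r)))
  (+ₚ-interchange (scale a q) (scale a r) (+0 ∷ (p *ₚ q)) (+0 ∷ (p *ₚ r)))

*ₚ-distribʳ : ∀ r p q → (p +ₚ q) *ₚ r ≋ p *ₚ r +ₚ q *ₚ r
*ₚ-distribʳ r p q = ≋-trans (*ₚ-comm (p +ₚ q) r)
  (≋-trans (*ₚ-distribˡ r p q) (+ₚ-cong (*ₚ-comm r p) (*ₚ-comm r q)))

scale-*ₚ : ∀ a q r → scale a q *ₚ r ≋ scale a (q *ₚ r)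
scale-*ₚ a []      r = ≋-refl
scale-*ₚ a (b ∷ q) r = ≋-trans
  (+ₚ-cong (≋-sym (scale-scale a b r)) (∷-cong (sym (ℤP.*-zeroʳ a)) (scale-*ₚ a q r)))
  (≋-sym (scale-+ₚ a (scale b r) (+0 ∷ (q *ₚ r))))

0∷-*ₚ : ∀ p q → (+0 ∷ p) *ₚ q ≋ +0 ∷ (p *ₚ q)
0∷-*ₚ p q = +ₚ-cong (scale-zero q) ≋-refl

*ₚ-assoc : ∀ p q r → (p *ₚ q) *ₚ r ≋ p *ₚ (q *ₚ r)
*ₚ-assoc []      q r = ≋-refl
*ₚ-assoc (a ∷ p) q r = ≋-trans (*ₚ-distribʳ r (scale a q) (+0 ∷ (p *ₚ q)))
  (+ₚ-cong (scale-*ₚ a q r) (≋-trans (0∷-*ₚ (p *ₚ q) r) (∷-cong refl (*ₚ-assoc p q r))))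

*ₚ-identityˡ : ∀ p → 1ₚ *ₚ p ≋ p
*ₚ-identityˡ p = mk≋ λ k → begin
  coeff (scale (+ 1) p +ₚ (+0 ∷ [])) k            ≡⟨ coeff-+ₚ (scale (+ 1) p) (+0 ∷ []) k ⟩
  coeff (scale (+ 1) p) k ℤ.+ coeff (+0 ∷ []) k   ≡⟨ cong₂ ℤ._+_ (coeff-scale (+ 1) p k) (coeff-0∷[] k) ⟩
  + 1 ℤ.* coeff p k ℤ.+ +0                        ≡⟨ ℤP.+-identityʳ _ ⟩
  + 1 ℤ.* coeff p k                               ≡⟨ ℤP.*-identityˡ _ ⟩
  coeff p k                                       ∎
  where
  open ≡-Reasoning
  coeff-0∷[] : ∀ k → coeff (+0 ∷ []) k ≡ +0
  coeff-0∷[] zero    = refl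
  coeff-0∷[] (suc k) = refl

ℤ[x] : CommutativeRing 0ℓ 0ℓ
ℤ[x] = record
  { Carrier = Poly ; _≈_ = _≋_ ; _+_ = _+ₚ_ ; _*_ = _*ₚ_ ; -_ = -ₚ_ ; 0# = [] ; 1# = 1ₚ
  ; isCommutativeRing = record
    { isRing = record
      { +-isAbelianGroup = record
        { isGroup = record
          { isMonoid = record
            { isSemigroup = record
              { isMagma = record
                { isEquivalence = record { refl = ≋-refl ; sym = ≋-sym ; trans = ≋-trans }
                ; ∙-cong = +ₚ-cong }
              ; assoc = +ₚ-assoc }
            ; identity = (λ _ → ≋-refl) , +ₚ-identityʳ }
          ; inverse = -ₚ‿inverseˡ , -ₚ‿inverseʳ
          ; ⁻¹-cong = -ₚ‿cong }
        ; comm = +ₚ-comm }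
      ; *-cong = *ₚ-cong
      ; *-assoc = *ₚ-assoc
      ; *-identity = *ₚ-identityˡ , λ p → ≋-trans (*ₚ-comm p 1ₚ) (*ₚ-identityˡ p)
      ; distrib = *ₚ-distribˡ , *ₚ-distribʳ }
    ; *-comm = *ₚ-comm } }

-- An incomplete zero test; the ring solver needs it to drop cancelled terms.
[]≋? : ∀ p → Maybe ([] ≋ p)
[]≋? []       = just ≋-refl
[]≋? (+0 ∷ p) = Maybe.map (λ []≋p → ≋-trans (≋-sym 0∷[]≋[]) (∷-cong refl []≋p)) ([]≋? p)
[]≋? (_ ∷ p)  = nothing

open CommutativeRing ℤ[x] using () renaming (setoid to ≋-setoid)
module ≋-Reasoning = Relation.Binary.Reasoning.Setoid ≋-setoid
open import Tactic.RingSolver.NonReflective (fromCommutativeRing ℤ[x] []≋?)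

X^-+ : ∀ a b → X^ a *ₚ X^ b ≋ X^ (a + b)
X^-+ zero    b = *ₚ-identityˡ (X^ b)
X^-+ (suc a) b = ≋-trans (0∷-*ₚ (X^ a) (X^ b)) (∷-cong refl (X^-+ a b))

coeff₀-*ₚ : ∀ p q → coeff (p *ₚ q) 0 ≡ coeff p 0 ℤ.* coeff q 0
coeff₀-*ₚ []      q = sym (ℤP.*-zeroˡ (coeff q 0))
coeff₀-*ₚ (a ∷ p) q = trans (coeff-+ₚ (scale a q) (+0 ∷ (p *ₚ q)) 0)
  (trans (ℤP.+-identityʳ _) (coeff-scale a q 0))

coeff₀-*ₚ-unitʳ : ∀ K p → coeff K 0 ≡ + 1 → coeff (p *ₚ K) 0 ≡ coeff p 0
coeff₀-*ₚ-unitʳ K p K₀≡1 = begin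
  coeff (p *ₚ K) 0            ≡⟨ coeff₀-*ₚ p K ⟩
  coeff p 0 ℤ.* coeff K 0     ≡⟨ cong (coeff p 0 ℤ.*_) K₀≡1 ⟩
  coeff p 0 ℤ.* + 1           ≡⟨ ℤP.*-identityʳ (coeff p 0) ⟩
  coeff p 0                   ∎
  where open ≡-Reasoning

*ₚ-noZeroDivisorʳ : ∀ K p → coeff K 0 ≡ + 1 → p *ₚ K ≋ [] → p ≋ []
*ₚ-noZeroDivisorʳ K []      K₀≡1 pK≋0 = ≋-refl
*ₚ-noZeroDivisorʳ K (a ∷ p) K₀≡1 pK≋0
  with refl ← trans (sym (coeff₀-*ₚ-unitʳ K (a ∷ p) K₀≡1)) (coeff-≡ pK≋0 0) =
  ≋-trans (∷-cong refl (*ₚ-noZeroDivisorʳ K p K₀≡1 (∷-injectiveʳ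
    (≋-trans (≋-sym (0∷-*ₚ p K)) (≋-trans pK≋0 (≋-sym 0∷[]≋[])))))) 0∷[]≋[]

*ₚ-cancelˡ : ∀ K {p q} → coeff K 0 ≡ + 1 → K *ₚ p ≋ K *ₚ q → p ≋ q
*ₚ-cancelˡ K {p} {q} K₀≡1 Kp≋Kq = ≋-trans (difference p q)
  (+ₚ-cong (*ₚ-noZeroDivisorʳ K (p -ₚ q) K₀≡1 (≋-trans (factor p q K)
    (≋-trans (+ₚ-cong Kp≋Kq ≋-refl) (-ₚ‿inverseʳ (K *ₚ q))))) (≋-refl {q}))
  where
  difference : ∀ p q → p ≋ (p -ₚ q) +ₚ q
  difference = solve 2 (λ p q → p ⊜ ((p ⊕ (⊝ q)) ⊕ q)) ≋-refl
  factor : ∀ p q K → (p -ₚ q) *ₚ K ≋ K *ₚ p -ₚ K *ₚ q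
  factor = solve 3 (λ p q K → (p ⊕ (⊝ q)) ⊗ K ⊜ (K ⊗ p ⊕ (⊝ (K ⊗ q)))) ≋-refl

C : ℤ → Poly
C a = a ∷ []

infixl 8 _∘ₚ_
_∘ₚ_ : Poly → Poly → Poly
[]      ∘ₚ g = []
(a ∷ f) ∘ₚ g = C a +ₚ g *ₚ (f ∘ₚ g)

≋[]⇒∘ₚ≋[] : ∀ f g → f ≋ [] → f ∘ₚ g ≋ []
≋[]⇒∘ₚ≋[] []      g f≋0 = ≋-refl
≋[]⇒∘ₚ≋[] (a ∷ f) g f≋0 = +ₚ-cong (≋-trans (∷-cong (coeff-≡ f≋0 0) ≋-refl) 0∷[]≋[])
  (≋-trans (*ₚ-congˡ g (≋[]⇒∘ₚ≋[] f g (∷-injectiveʳ (≋-trans f≋0 (≋-sym 0∷[]≋[])))))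
    (*ₚ-zeroʳ g))

∘ₚ-congʳ : ∀ g {f f′} → f ≋ f′ → f ∘ₚ g ≋ f′ ∘ₚ g
∘ₚ-congʳ g {[]}    {f′}     f≋f′ = ≋-sym (≋[]⇒∘ₚ≋[] f′ g (≋-sym f≋f′))
∘ₚ-congʳ g {a ∷ f} {[]}     f≋f′ = ≋[]⇒∘ₚ≋[] (a ∷ f) g f≋f′
∘ₚ-congʳ g {a ∷ f} {b ∷ f′} f≋f′ =
  +ₚ-cong (∷-cong (coeff-≡ f≋f′ 0) ≋-refl) (*ₚ-congˡ g (∘ₚ-congʳ g (∷-injectiveʳ f≋f′)))

+ₚ-∘ₚ : ∀ f h g → (f +ₚ h) ∘ₚ g ≋ f ∘ₚ g +ₚ h ∘ₚ g
+ₚ-∘ₚ []      h       g = ≋-refl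
+ₚ-∘ₚ (a ∷ f) []      g = ≋-sym (+ₚ-identityʳ _)
+ₚ-∘ₚ (a ∷ f) (b ∷ h) g = ≋-trans (+ₚ-cong ≋-refl (*ₚ-congˡ g (+ₚ-∘ₚ f h g)))
  (rearrange (C a) (C b) g (f ∘ₚ g) (h ∘ₚ g))
  where
  rearrange : ∀ a b g f h → (a +ₚ b) +ₚ g *ₚ (f +ₚ h) ≋ (a +ₚ g *ₚ f) +ₚ (b +ₚ g *ₚ h)
  rearrange = solve 5 (λ a b g f h → (a ⊕ b) ⊕ g ⊗ (f ⊕ h) ⊜ ((a ⊕ g ⊗ f) ⊕ (b ⊕ g ⊗ h))) ≋-refl

-ₚ-∘ₚ : ∀ f g → (-ₚ f) ∘ₚ g ≋ -ₚ (f ∘ₚ g)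
-ₚ-∘ₚ []      g = ≋-refl
-ₚ-∘ₚ (a ∷ f) g = ≋-trans (+ₚ-cong ≋-refl (*ₚ-congˡ g (-ₚ-∘ₚ f g))) (rearrange (C a) g (f ∘ₚ g))
  where
  rearrange : ∀ a g f → (-ₚ a) +ₚ g *ₚ (-ₚ f) ≋ -ₚ (a +ₚ g *ₚ f)
  rearrange = solve 3 (λ a g f → (⊝ a) ⊕ g ⊗ (⊝ f) ⊜ (⊝ (a ⊕ g ⊗ f))) ≋-refl

C-* : ∀ a b → C (a ℤ.* b) ≋ C a *ₚ C b
C-* a b = ∷-cong (sym (ℤP.+-identityʳ _)) ≋-refl

scale-∘ₚ : ∀ a f g → scale a f ∘ₚ g ≋ C a *ₚ (f ∘ₚ g)
scale-∘ₚ a []      g = ≋-sym (*ₚ-zeroʳ (C a))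
scale-∘ₚ a (b ∷ f) g = ≋-trans (+ₚ-cong (C-* a b) (*ₚ-congˡ g (scale-∘ₚ a f g)))
  (rearrange (C a) (C b) g (f ∘ₚ g))
  where
  rearrange : ∀ a b g f → a *ₚ b +ₚ g *ₚ (a *ₚ f) ≋ a *ₚ (b +ₚ g *ₚ f)
  rearrange = solve 4 (λ a b g f → a ⊗ b ⊕ g ⊗ (a ⊗ f) ⊜ (a ⊗ (b ⊕ g ⊗ f))) ≋-refl

*ₚ-∘ₚ : ∀ f h g → (f *ₚ h) ∘ₚ g ≋ f ∘ₚ g *ₚ h ∘ₚ g
*ₚ-∘ₚ []      h g = ≋-refl
*ₚ-∘ₚ (a ∷ f) h g = ≋-trans (+ₚ-∘ₚ (scale a h) (+0 ∷ (f *ₚ h)) g)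
  (≋-trans (+ₚ-cong (scale-∘ₚ a h g) (+ₚ-cong 0∷[]≋[] (*ₚ-congˡ g (*ₚ-∘ₚ f h g))))
    (rearrange (C a) g (f ∘ₚ g) (h ∘ₚ g)))
  where
  rearrange : ∀ a g f h → a *ₚ h +ₚ ([] +ₚ g *ₚ (f *ₚ h)) ≋ (a +ₚ g *ₚ f) *ₚ h
  rearrange = solve 4 (λ a g f h → a ⊗ h ⊕ (Κ [] ⊕ g ⊗ (f ⊗ h)) ⊜ ((a ⊕ g ⊗ f) ⊗ h)) ≋-refl

1ₚ-∘ₚ : ∀ g → 1ₚ ∘ₚ g ≋ 1ₚ
1ₚ-∘ₚ g = ≋-trans (+ₚ-cong (≋-refl {1ₚ}) (*ₚ-zeroʳ g)) (+ₚ-identityʳ 1ₚ)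

replicate-0-++ : ∀ d s → replicate d +0 ++ s ≋ X^ d *ₚ s
replicate-0-++ zero    s = ≋-sym (*ₚ-identityˡ s)
replicate-0-++ (suc d) s = ≋-trans (∷-cong refl (replicate-0-++ d s)) (≋-sym (0∷-*ₚ (X^ d) s))

subX^≋∘ₚX^ : ∀ d f → subX^ d f ≋ f ∘ₚ X^ d
subX^≋∘ₚX^ d []      = ≋-refl
subX^≋∘ₚX^ d (a ∷ f) = +ₚ-cong (≋-refl {C a})
  (≋-trans (replicate-0-++ d (subX^ d f)) (*ₚ-congˡ (X^ d) (subX^≋∘ₚX^ d f)))

X^-∘ₚ-X^ : ∀ k d → X^ k ∘ₚ X^ d ≋ X^ (k * d)
X^-∘ₚ-X^ zero    d = 1ₚ-∘ₚ (X^ d)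
X^-∘ₚ-X^ (suc k) d = ≋-trans (+ₚ-cong 0∷[]≋[] (*ₚ-congˡ (X^ d) (X^-∘ₚ-X^ k d))) (X^-+ d (k * d))

1-X^-∘ₚ-X^ : ∀ k d → (1ₚ -ₚ X^ k) ∘ₚ X^ d ≋ 1ₚ -ₚ X^ (k * d)
1-X^-∘ₚ-X^ k d = ≋-trans (+ₚ-∘ₚ 1ₚ (-ₚ X^ k) (X^ d))
  (+ₚ-cong (1ₚ-∘ₚ (X^ d)) (≋-trans (-ₚ-∘ₚ (X^ k) (X^ d)) (-ₚ‿cong (X^-∘ₚ-X^ k d))))

⌊⌋-true : ∀ {A : Set} (a? : Dec A) → A → ⌊ a? ⌋ ≡ true
⌊⌋-true a? a = trans (isYes≗does a?) (dec-true a? a)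

⌊⌋-false : ∀ {A : Set} (a? : Dec A) → ¬ A → ⌊ a? ⌋ ≡ false
⌊⌋-false a? ¬a = trans (isYes≗does a?) (dec-false a? ¬a)

≟-punchIn : ∀ {m} i (k a : Fin m) → ⌊ punchIn i k ≟ᶠ punchIn i a ⌋ ≡ ⌊ k ≟ᶠ a ⌋
≟-punchIn i k a with k ≟ᶠ a
... | yes refl = ⌊⌋-true (punchIn i k ≟ᶠ punchIn i k) refl
... | no  k≢a  = ⌊⌋-false (punchIn i k ≟ᶠ punchIn i a) (k≢a ∘ punchIn-injective i k a)

punchIn-≟-self : ∀ {m} i (k : Fin m) → ⌊ punchIn i k ≟ᶠ i ⌋ ≡ false
punchIn-≟-self i k = ⌊⌋-false (punchIn i k ≟ᶠ i) (punchInᵢ≢i i k)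

self-≟-punchIn : ∀ {m} i (k : Fin m) → ⌊ i ≟ᶠ punchIn i k ⌋ ≡ false
self-≟-punchIn i k = ⌊⌋-false (i ≟ᶠ punchIn i k) (punchInᵢ≢i i k ∘ sym)

≟-self : ∀ {m} (i : Fin m) → ⌊ i ≟ᶠ i ⌋ ≡ true
≟-self i = ⌊⌋-true (i ≟ᶠ i) refl

module FinProduct {c ℓ} (M : CommutativeMonoid c ℓ) where

  open CommutativeMonoid M renaming (refl to ≈-refl; sym to ≈-sym; trans to ≈-trans)
  open CommutativeMonoidProduct M using (sum-remove; sum-cong-≋; ∑-distrib-+)
  open CommutativeMonoidProduct M public using (sum)
  open Relation.Binary.Reasoning.Setoid setoid

  -- For the monoids (ℕ, *, 1) and (Poly, *ₚ, 1ₚ) this is definitionally ∏ℕ and ∏ₚ.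
  ∏ : ∀ {m} → (Fin m → Carrier) → Carrier
  ∏ {m} f = List.foldr (λ a acc → f a ∙ acc) ε (List.allFin m)

  ∏≡sum : ∀ {m} (f : Fin m → Carrier) → ∏ f ≡ sum f
  ∏≡sum f = foldr-tabulate f (λ k → k)
    where
    foldr-tabulate : ∀ {m n} (f : Fin n → Carrier) (h : Fin m → Fin n) →
                     List.foldr (λ a acc → f a ∙ acc) ε (tabulate h) ≡ sum (f ∘ h)
    foldr-tabulate {zero}  f h = refl
    foldr-tabulate {suc m} f h = cong (f (h zero) ∙_) (foldr-tabulate f (h ∘ suc))

  ∏-removeAt : ∀ {m} i (f : Fin (suc m) → Carrier) → ∏ f ≈ f i ∙ ∏ (removeAt f i)
  ∏-removeAt i f rewrite ∏≡sum f | ∏≡sum (removeAt f i) = sum-remove {i = i} f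

  ∏-cong : ∀ {m} {f g : Fin m → Carrier} → (∀ k → f k ≈ g k) → ∏ f ≈ ∏ g
  ∏-cong {f = f} {g} f≈g rewrite ∏≡sum f | ∏≡sum g = sum-cong-≋ f≈g

  ∏-distrib : ∀ {m} (f g : Fin m → Carrier) → ∏ (λ k → f k ∙ g k) ≈ ∏ f ∙ ∏ g
  ∏-distrib f g rewrite ∏≡sum (λ k → f k ∙ g k) | ∏≡sum f | ∏≡sum g = ∑-distrib-+ f g

  ∏-if-cong : ∀ {m} (f : Fin m → Carrier) {b c : Fin m → Bool} → (∀ k → b k ≡ c k) →
              ∏ (λ k → if b k then ε else f k) ≈ ∏ (λ k → if c k then ε else f k)
  ∏-if-cong f b≗c = ∏-cong λ k → reflexive (cong (λ b → if b then ε else f k) (b≗c k))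

  ∏-except-removeAt : ∀ {m} (f : Fin (suc m) → Carrier) {i j} → j ≢ i →
    ∏ (λ k → if ⌊ k ≟ᶠ i ⌋ then ε else f k) ≈ f j ∙ ∏ (λ k → if ⌊ k ≟ᶠ i ⌋ ∨ ⌊ k ≟ᶠ j ⌋ then ε else f k)
  ∏-except-removeAt f {i} {j} j≢i = begin
    ∏ (λ k → if ⌊ k ≟ᶠ i ⌋ then ε else f k)
      ≈⟨ ∏-removeAt j _ ⟩
    (if ⌊ j ≟ᶠ i ⌋ then ε else f j) ∙ ∏ (λ k → if ⌊ punchIn j k ≟ᶠ i ⌋ then ε else f (punchIn j k))
      ≈⟨ ∙-congʳ (reflexive (cong (λ b → if b then ε else f j) (⌊⌋-false (j ≟ᶠ i) j≢i))) ⟩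
    f j ∙ ∏ (λ k → if ⌊ punchIn j k ≟ᶠ i ⌋ then ε else f (punchIn j k))
      ≈⟨ ∙-congˡ (≈-sym (identityˡ _)) ⟩
    f j ∙ (ε ∙ ∏ (λ k → if ⌊ punchIn j k ≟ᶠ i ⌋ then ε else f (punchIn j k)))
      ≈⟨ ∙-congˡ (∙-cong (reflexive (cong (λ b → if b then ε else f j) (sym j-excluded)))
                          (∏-if-cong (removeAt f j) (λ k → sym (punchIn-excluded k)))) ⟩
    f j ∙ ((if ⌊ j ≟ᶠ i ⌋ ∨ ⌊ j ≟ᶠ j ⌋ then ε else f j) ∙
           ∏ (λ k → if ⌊ punchIn j k ≟ᶠ i ⌋ ∨ ⌊ punchIn j k ≟ᶠ j ⌋ then ε else f (punchIn j k)))
      ≈⟨ ∙-congˡ (∏-removeAt j _) ⟨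
    f j ∙ ∏ (λ k → if ⌊ k ≟ᶠ i ⌋ ∨ ⌊ k ≟ᶠ j ⌋ then ε else f k) ∎
    where
    j-excluded : (⌊ j ≟ᶠ i ⌋ ∨ ⌊ j ≟ᶠ j ⌋) ≡ true
    j-excluded = trans (cong (⌊ j ≟ᶠ i ⌋ ∨_) (≟-self j)) (∨-zeroʳ _)
    punchIn-excluded : ∀ k → (⌊ punchIn j k ≟ᶠ i ⌋ ∨ ⌊ punchIn j k ≟ᶠ j ⌋) ≡ ⌊ punchIn j k ≟ᶠ i ⌋
    punchIn-excluded k = trans (cong (⌊ punchIn j k ≟ᶠ i ⌋ ∨_) (punchIn-≟-self j k)) (∨-identityʳ _)

  ∏-except-self : ∀ {m} (f : Fin (suc m) → Carrier) i →
                  ∏ (λ k → if ⌊ k ≟ᶠ i ⌋ then ε else f k) ≈ ∏ (removeAt f i)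
  ∏-except-self f i = begin
    ∏ (λ k → if ⌊ k ≟ᶠ i ⌋ then ε else f k)
      ≈⟨ ∏-removeAt i (λ k → if ⌊ k ≟ᶠ i ⌋ then ε else f k) ⟩
    (if ⌊ i ≟ᶠ i ⌋ then ε else f i) ∙ ∏ (λ k → if ⌊ punchIn i k ≟ᶠ i ⌋ then ε else f (punchIn i k))
      ≈⟨ ∙-cong (reflexive (cong (λ b → if b then ε else f i) (≟-self i)))
                (∏-if-cong (removeAt f i) (punchIn-≟-self i)) ⟩
    ε ∙ ∏ (removeAt f i)
      ≈⟨ identityˡ _ ⟩
    ∏ (removeAt f i) ∎

  ∏²-removeAt : ∀ {m} i (h : Fin (suc m) → Fin (suc m) → Carrier) →
    ∏ (λ a → ∏ (h a)) ≈
    h i i ∙ (∏ (λ b → h (punchIn i b) i ∙ h i (punchIn i b)) ∙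
             ∏ (λ a → ∏ (λ b → h (punchIn i a) (punchIn i b))))
  ∏²-removeAt {m} i h = begin
    ∏ (λ a → ∏ (h a))
      ≈⟨ ∏-cong (λ a → ∏-removeAt i (h a)) ⟩
    ∏ (λ a → h a i ∙ ∏ (λ b → h a (punchIn i b)))
      ≈⟨ ∏-distrib (λ a → h a i) _ ⟩
    ∏ (λ a → h a i) ∙ ∏ (λ a → ∏ (λ b → h a (punchIn i b)))
      ≈⟨ ∙-cong (∏-removeAt i (λ a → h a i)) (∏-removeAt i (λ a → ∏ (λ b → h a (punchIn i b)))) ⟩
    (h i i ∙ ∏ column) ∙ (∏ row ∙ rest)
      ≈⟨ assoc (h i i) (∏ column) (∏ row ∙ rest) ⟩
    h i i ∙ (∏ column ∙ (∏ row ∙ rest))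
      ≈⟨ ∙-congˡ (≈-sym (assoc (∏ column) (∏ row) rest)) ⟩
    h i i ∙ ((∏ column ∙ ∏ row) ∙ rest)
      ≈⟨ ∙-congˡ (∙-congʳ (∏-distrib column row)) ⟨
    h i i ∙ (∏ (λ b → column b ∙ row b) ∙ rest) ∎
    where
    column row : Fin m → Carrier
    column b = h (punchIn i b) i
    row b = h i (punchIn i b)
    rest : Carrier
    rest = ∏ (λ a → ∏ (λ b → h (punchIn i a) (punchIn i b)))

module ℕΠ = FinProduct ℕP.*-1-commutativeMonoid
module ℤ[x]Π = FinProduct (CommutativeRing.*-commutativeMonoid ℤ[x])

∏ℕ-nonZero : ∀ {m} (f : Fin m → ℕ) → (∀ k → ℕ.NonZero (f k)) → ℕ.NonZero (∏ℕ f)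
∏ℕ-nonZero f f≢0 rewrite ℕΠ.∏≡sum f = nonZero f f≢0
  where
  nonZero : ∀ {m} (f : Fin m → ℕ) → (∀ k → ℕ.NonZero (f k)) → ℕ.NonZero (ℕΠ.sum f)
  nonZero {zero}  f f≢0 = _
  nonZero {suc m} f f≢0 = ℕP.m*n≢0 (f zero) _ {{f≢0 zero}} {{nonZero (f ∘ suc) (f≢0 ∘ suc)}}

∏ₚ-∘ₚ : ∀ {m} (f : Fin m → Poly) g → ∏ₚ f ∘ₚ g ≋ ∏ₚ (λ k → f k ∘ₚ g)
∏ₚ-∘ₚ f g rewrite ℤ[x]Π.∏≡sum f | ℤ[x]Π.∏≡sum (λ k → f k ∘ₚ g) = ∏-∘ₚ f
  where
  ∏-∘ₚ : ∀ {m} (f : Fin m → Poly) → ℤ[x]Π.sum f ∘ₚ g ≋ ℤ[x]Π.sum (λ k → f k ∘ₚ g)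
  ∏-∘ₚ {zero}  f = 1ₚ-∘ₚ g
  ∏-∘ₚ {suc m} f = ≋-trans (*ₚ-∘ₚ (f zero) _ g) (*ₚ-congˡ (f zero ∘ₚ g) (∏-∘ₚ (f ∘ suc)))

coeff₀-∏ₚ : ∀ {m} (f : Fin m → Poly) → (∀ k → coeff (f k) 0 ≡ + 1) → coeff (∏ₚ f) 0 ≡ + 1
coeff₀-∏ₚ f f₀≡1 rewrite ℤ[x]Π.∏≡sum f = coeff₀-∏ f f₀≡1
  where
  coeff₀-∏ : ∀ {m} (f : Fin m → Poly) → (∀ k → coeff (f k) 0 ≡ + 1) → coeff (ℤ[x]Π.sum f) 0 ≡ + 1
  coeff₀-∏ {zero}  f f₀≡1 = refl
  coeff₀-∏ {suc m} f f₀≡1 =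
    trans (coeff₀-*ₚ-unitʳ _ (f zero) (coeff₀-∏ (f ∘ suc) (f₀≡1 ∘ suc))) (f₀≡1 zero)

if-nonZero : ∀ b n → ℕ.NonZero n → ℕ.NonZero (if b then 1 else n)
if-nonZero true  n n≢0 = _
if-nonZero false n n≢0 = n≢0

module _ {m} (q : Fin (suc m) → ℕ) where

  Mof-removeAt : ∀ i → Mof q ≡ q i * Mof (removeAt q i)
  Mof-removeAt i = ℕΠ.∏-removeAt i q

  M₁-self : ∀ i → M₁ q i ≡ Mof (removeAt q i)
  M₁-self = ℕΠ.∏-except-self q

  M₁-punchIn : ∀ i a → M₁ q (punchIn i a) ≡ q i * M₁ (removeAt q i) a
  M₁-punchIn i a = trans (ℕΠ.∏-removeAt i λ k → if ⌊ k ≟ᶠ punchIn i a ⌋ then 1 else q k)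
    (cong₂ _*_ (cong (λ b → if b then 1 else q i) (self-≟-punchIn i a))
                 (ℕΠ.∏-if-cong (removeAt q i) (λ k → ≟-punchIn i k a)))

  M₂-punchIn : ∀ i a b → M₂ q (punchIn i a) (punchIn i b) ≡ q i * M₂ (removeAt q i) a b
  M₂-punchIn i a b = trans
    (ℕΠ.∏-removeAt i λ k → if ⌊ k ≟ᶠ punchIn i a ⌋ ∨ ⌊ k ≟ᶠ punchIn i b ⌋ then 1 else q k)
    (cong₂ _*_ (cong (λ b → if b then 1 else q i) (cong₂ _∨_ (self-≟-punchIn i a) (self-≟-punchIn i b)))
                 (ℕΠ.∏-if-cong (removeAt q i) (λ k → cong₂ _∨_ (≟-punchIn i k a) (≟-punchIn i k b))))

  M₂-comm : ∀ a b → M₂ q a b ≡ M₂ q b a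
  M₂-comm a b = ℕΠ.∏-if-cong q (λ k → ∨-comm ⌊ k ≟ᶠ a ⌋ ⌊ k ≟ᶠ b ⌋)

  M₁≡*M₂ : ∀ {i j} → j ≢ i → M₁ q i ≡ q j * M₂ q i j
  M₁≡*M₂ = ℕΠ.∏-except-removeAt q

  module _ (q≢0 : ∀ k → ℕ.NonZero (q k)) where

    M₁-nonZero : ∀ a → ℕ.NonZero (M₁ q a)
    M₁-nonZero a = ∏ℕ-nonZero _ λ k → if-nonZero ⌊ k ≟ᶠ a ⌋ (q k) (q≢0 k)

    M₂-nonZero : ∀ a b → ℕ.NonZero (M₂ q a b)
    M₂-nonZero a b = ∏ℕ-nonZero _ λ k → if-nonZero (⌊ k ≟ᶠ a ⌋ ∨ ⌊ k ≟ᶠ b ⌋) (q k) (q≢0 k)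

pairProduct : ∀ {m} → (Fin m → ℕ) → Poly
pairProduct q = ∏ₚ (λ a → ∏ₚ (λ b → if toℕ a <ᵇ toℕ b then 1ₚ -ₚ X^ (M₂ q a b) else 1ₚ))

<ᵇ-irrefl : ∀ n → (n <ᵇ n) ≡ false
<ᵇ-irrefl zero    = refl
<ᵇ-irrefl (suc n) = <ᵇ-irrefl n

toℕ-punchIn-<ᵇ : ∀ {m} i (a b : Fin m) → (toℕ (punchIn i a) <ᵇ toℕ (punchIn i b)) ≡ (toℕ a <ᵇ toℕ b)
toℕ-punchIn-<ᵇ zero    a       b       = refl
toℕ-punchIn-<ᵇ (suc i) zero    zero    = refl
toℕ-punchIn-<ᵇ (suc i) zero    (suc b) = refl
toℕ-punchIn-<ᵇ (suc i) (suc a) zero    = refl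
toℕ-punchIn-<ᵇ (suc i) (suc a) (suc b) = toℕ-punchIn-<ᵇ i a b

if-<ᵇ-pair : ∀ x y → x ≢ y → ∀ {u v} → u ≋ v →
             (if x <ᵇ y then u else 1ₚ) *ₚ (if y <ᵇ x then v else 1ₚ) ≋ v
if-<ᵇ-pair zero    zero    x≢y u≋v = ⊥-elim (x≢y refl)
if-<ᵇ-pair zero    (suc y) x≢y {u} u≋v = ≋-trans (≋-trans (*ₚ-comm u 1ₚ) (*ₚ-identityˡ u)) u≋v
if-<ᵇ-pair (suc x) zero    x≢y {v = v} u≋v = *ₚ-identityˡ v
if-<ᵇ-pair (suc x) (suc y) x≢y u≋v = if-<ᵇ-pair x y (x≢y ∘ cong suc) u≋v

1-X^-cong : ∀ {a b} → a ≡ b → 1ₚ -ₚ X^ a ≋ 1ₚ -ₚ X^ b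
1-X^-cong a≡b = ≡⇒≋ (cong (λ e → 1ₚ -ₚ X^ e) a≡b)

IsP-*ₚ : ∀ {m} (q : Fin m → ℕ) w Q → IsP q Q → denP q *ₚ w *ₚ Q ≋ w *ₚ numP q
IsP-*ₚ q w Q isP = ≋-trans (regroup (denP q) w Q) (*ₚ-congˡ w (mk≋ {Q *ₚ denP q} {numP q} isP))
  where
  regroup : ∀ D w Q → D *ₚ w *ₚ Q ≋ w *ₚ (Q *ₚ D)
  regroup = solve 3 (λ D w Q → D ⊗ w ⊗ Q ⊜ w ⊗ (Q ⊗ D)) ≋-refl

module _ {m} (q : Fin (suc m) → ℕ) where

  denP-removeAt : ∀ i → denP q ≋ (1ₚ -ₚ X^ (M₁ q i)) *ₚ denP (removeAt q i) ∘ₚ X^ (q i)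
  denP-removeAt i = begin
    denP q
      ≈⟨ ℤ[x]Π.∏-removeAt i (λ a → 1ₚ -ₚ X^ (M₁ q a)) ⟩
    (1ₚ -ₚ X^ (M₁ q i)) *ₚ ∏ₚ (λ a → 1ₚ -ₚ X^ (M₁ q (punchIn i a)))
      ≈⟨ *ₚ-congˡ (1ₚ -ₚ X^ (M₁ q i)) (ℤ[x]Π.∏-cong factor) ⟨
    (1ₚ -ₚ X^ (M₁ q i)) *ₚ ∏ₚ (λ a → (1ₚ -ₚ X^ (M₁ (removeAt q i) a)) ∘ₚ X^ (q i))
      ≈⟨ *ₚ-congˡ (1ₚ -ₚ X^ (M₁ q i)) (∏ₚ-∘ₚ (λ a → 1ₚ -ₚ X^ (M₁ (removeAt q i) a)) (X^ (q i))) ⟨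
    (1ₚ -ₚ X^ (M₁ q i)) *ₚ denP (removeAt q i) ∘ₚ X^ (q i) ∎
    where
    open ≋-Reasoning
    factor : ∀ a → (1ₚ -ₚ X^ (M₁ (removeAt q i) a)) ∘ₚ X^ (q i) ≋ 1ₚ -ₚ X^ (M₁ q (punchIn i a))
    factor a = ≋-trans (1-X^-∘ₚ-X^ (M₁ (removeAt q i) a) (q i))
      (1-X^-cong (trans (ℕP.*-comm (M₁ (removeAt q i) a) (q i)) (sym (M₁-punchIn q i a))))

  pairProduct-removeAt : ∀ i →
    pairProduct q ≋
    pairProduct (removeAt q i) ∘ₚ X^ (q i) *ₚ ∏ₚ (λ k → if ⌊ k ≟ᶠ i ⌋ then 1ₚ else 1ₚ -ₚ X^ (M₂ q i k))
  pairProduct-removeAt i = begin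
    pairProduct q
      ≈⟨ ℤ[x]Π.∏²-removeAt i h ⟩
    h i i *ₚ (∏ₚ (λ b → h (punchIn i b) i *ₚ h i (punchIn i b)) *ₚ rest)
      ≈⟨ *ₚ-cong diagonal (*ₚ-cong (ℤ[x]Π.∏-cong cross) rows) ⟩
    1ₚ *ₚ (others *ₚ below)
      ≈⟨ *ₚ-identityˡ (others *ₚ below) ⟩
    others *ₚ below
      ≈⟨ *ₚ-comm others below ⟩
    below *ₚ others
      ≈⟨ *ₚ-congˡ below (ℤ[x]Π.∏-except-self (g i) i) ⟨
    pairProduct (removeAt q i) ∘ₚ X^ (q i) *ₚ ∏ₚ (λ k → if ⌊ k ≟ᶠ i ⌋ then 1ₚ else g i k) ∎
    where
    open ≋-Reasoning
    g : Fin (suc m) → Fin (suc m) → Poly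
    g a b = 1ₚ -ₚ X^ (M₂ q a b)
    h : Fin (suc m) → Fin (suc m) → Poly
    h a b = if toℕ a <ᵇ toℕ b then g a b else 1ₚ
    rest others below : Poly
    rest = ∏ₚ (λ a → ∏ₚ (λ b → h (punchIn i a) (punchIn i b)))
    others = ∏ₚ (λ b → g i (punchIn i b))
    below = pairProduct (removeAt q i) ∘ₚ X^ (q i)
    diagonal : h i i ≋ 1ₚ
    diagonal = ≡⇒≋ (cong (λ b → if b then g i i else 1ₚ) (<ᵇ-irrefl (toℕ i)))
    cross : ∀ b → h (punchIn i b) i *ₚ h i (punchIn i b) ≋ g i (punchIn i b)
    cross b = if-<ᵇ-pair (toℕ (punchIn i b)) (toℕ i) (punchInᵢ≢i i b ∘ toℕ-injective)
                         (1-X^-cong (M₂-comm q (punchIn i b) i))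
    entryᵣ : Fin m → Fin m → Poly
    entryᵣ a b = if toℕ a <ᵇ toℕ b then 1ₚ -ₚ X^ (M₂ (removeAt q i) a b) else 1ₚ
    entry : ∀ a b → entryᵣ a b ∘ₚ X^ (q i) ≋ h (punchIn i a) (punchIn i b)
    entry a b rewrite toℕ-punchIn-<ᵇ i a b with toℕ a <ᵇ toℕ b
    ... | true  = ≋-trans (1-X^-∘ₚ-X^ (M₂ (removeAt q i) a b) (q i))
      (1-X^-cong (trans (ℕP.*-comm (M₂ (removeAt q i) a b) (q i)) (sym (M₂-punchIn q i a b))))
    ... | false = 1ₚ-∘ₚ (X^ (q i))
    rows : rest ≋ pairProduct (removeAt q i) ∘ₚ X^ (q i)
    rows = ≋-sym (≋-trans (∏ₚ-∘ₚ (λ a → ∏ₚ (λ b → entryᵣ a b)) (X^ (q i)))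
      (ℤ[x]Π.∏-cong λ a → ≋-trans (∏ₚ-∘ₚ (entryᵣ a) (X^ (q i))) (ℤ[x]Π.∏-cong (entry a))))

  cofactor : Fin (suc m) → Fin (suc m) → Fin (suc m) → Poly
  cofactor s i j = ∏ₚ (λ k → if ⌊ k ≟ᶠ i ⌋ ∨ ⌊ k ≟ᶠ j ⌋ then 1ₚ else 1ₚ -ₚ X^ (M₂ q s k))

  pairProduct-removeAt² : ∀ {i j} → j ≢ i →
    pairProduct q ≋ pairProduct (removeAt q i) ∘ₚ X^ (q i) *ₚ ((1ₚ -ₚ X^ (M₂ q i j)) *ₚ cofactor i i j)
  pairProduct-removeAt² {i} {j} j≢i = ≋-trans (pairProduct-removeAt i)
    (*ₚ-congˡ (pairProduct (removeAt q i) ∘ₚ X^ (q i))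
      (ℤ[x]Π.∏-except-removeAt (λ k → 1ₚ -ₚ X^ (M₂ q i k)) j≢i))

  IsP-∘ₚ : ∀ i Q → IsP (removeAt q i) Q →
           Q ∘ₚ X^ (q i) *ₚ denP (removeAt q i) ∘ₚ X^ (q i) ≋
           (1ₚ -ₚ X^ (Mof q)) *ₚ pairProduct (removeAt q i) ∘ₚ X^ (q i)
  IsP-∘ₚ i Q isP = begin
    Q ∘ₚ X^ (q i) *ₚ denP (removeAt q i) ∘ₚ X^ (q i)
      ≈⟨ *ₚ-∘ₚ Q (denP (removeAt q i)) (X^ (q i)) ⟨
    (Q *ₚ denP (removeAt q i)) ∘ₚ X^ (q i)
      ≈⟨ ∘ₚ-congʳ (X^ (q i)) (mk≋ {Q *ₚ denP (removeAt q i)} {numP (removeAt q i)} isP) ⟩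
    numP (removeAt q i) ∘ₚ X^ (q i)
      ≈⟨ *ₚ-∘ₚ (1ₚ -ₚ X^ (Mof (removeAt q i))) (pairProduct (removeAt q i)) (X^ (q i)) ⟩
    (1ₚ -ₚ X^ (Mof (removeAt q i))) ∘ₚ X^ (q i) *ₚ pairProduct (removeAt q i) ∘ₚ X^ (q i)
      ≈⟨ *ₚ-congʳ _ (≋-trans (1-X^-∘ₚ-X^ (Mof (removeAt q i)) (q i))
           (1-X^-cong (trans (ℕP.*-comm (Mof (removeAt q i)) (q i)) (sym (Mof-removeAt q i))))) ⟩
    (1ₚ -ₚ X^ (Mof q)) *ₚ pairProduct (removeAt q i) ∘ₚ X^ (q i) ∎
    where open ≋-Reasoning

  liftedP-identity : ∀ {i j} → j ≢ i → ∀ Q → IsP (removeAt q i) Q →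
    denP q *ₚ (1ₚ -ₚ X^ (M₂ q i j)) *ₚ (subX^ (q i) Q *ₚ cofactor i i j) ≋ (1ₚ -ₚ X^ (M₁ q i)) *ₚ numP q
  liftedP-identity {i} {j} j≢i Q isP = begin
    denP q *ₚ w *ₚ (subX^ (q i) Q *ₚ Π)  ≈⟨ *ₚ-congˡ (denP q *ₚ w) (*ₚ-congʳ Π (subX^≋∘ₚX^ (q i) Q)) ⟩
    denP q *ₚ w *ₚ (Q′ *ₚ Π)              ≈⟨ *ₚ-congʳ (Q′ *ₚ Π) (*ₚ-congʳ w (denP-removeAt i)) ⟩
    u *ₚ D′ *ₚ w *ₚ (Q′ *ₚ Π)             ≈⟨ regroup u D′ w Q′ Π ⟩
    u *ₚ ((Q′ *ₚ D′) *ₚ (w *ₚ Π))         ≈⟨ *ₚ-congˡ u (*ₚ-congʳ (w *ₚ Π) (IsP-∘ₚ i Q isP)) ⟩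
    u *ₚ ((1ₚ -ₚ n) *ₚ F′ *ₚ (w *ₚ Π))    ≈⟨ *ₚ-congˡ u (*ₚ-assoc (1ₚ -ₚ n) F′ (w *ₚ Π)) ⟩
    u *ₚ ((1ₚ -ₚ n) *ₚ (F′ *ₚ (w *ₚ Π)))  ≈⟨ *ₚ-congˡ u (*ₚ-congˡ (1ₚ -ₚ n) (pairProduct-removeAt² j≢i)) ⟨
    u *ₚ numP q                            ∎
    where
    open ≋-Reasoning
    u w n Q′ D′ F′ Π : Poly
    u = 1ₚ -ₚ X^ (M₁ q i)
    w = 1ₚ -ₚ X^ (M₂ q i j)
    n = X^ (Mof q)
    Q′ = Q ∘ₚ X^ (q i)
    D′ = denP (removeAt q i) ∘ₚ X^ (q i)
    F′ = pairProduct (removeAt q i) ∘ₚ X^ (q i)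
    Π = cofactor i i j
    regroup : ∀ u D w Q Π → u *ₚ D *ₚ w *ₚ (Q *ₚ Π) ≋ u *ₚ ((Q *ₚ D) *ₚ (w *ₚ Π))
    regroup = solve 5 (λ u D w Q Π → u ⊗ D ⊗ w ⊗ (Q ⊗ Π) ⊜ u ⊗ ((Q ⊗ D) ⊗ (w ⊗ Π))) ≋-refl

  liftedP-identity′ : ∀ {i j} → i ≢ j → ∀ Q → IsP (removeAt q j) Q →
    denP q *ₚ (1ₚ -ₚ X^ (M₂ q i j)) *ₚ (subX^ (q j) Q *ₚ cofactor j i j) ≋ (1ₚ -ₚ X^ (M₁ q j)) *ₚ numP q
  liftedP-identity′ {i} {j} i≢j Q isP = ≋-trans
    (*ₚ-cong (*ₚ-congˡ (denP q) (1-X^-cong (M₂-comm q i j)))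
             (*ₚ-congˡ (subX^ (q j) Q) (ℤ[x]Π.∏-if-cong (λ k → 1ₚ -ₚ X^ (M₂ q j k))
                                                         (λ k → ∨-comm ⌊ k ≟ᶠ i ⌋ ⌊ k ≟ᶠ j ⌋))))
    (liftedP-identity i≢j Q isP)

geometric : ℕ → ℕ → Poly
geometric d zero    = []
geometric d (suc c) = 1ₚ +ₚ X^ d *ₚ geometric d c

geometric-*ₚ : ∀ d c → geometric d c *ₚ (1ₚ -ₚ X^ d) ≋ 1ₚ -ₚ X^ (c * d)
geometric-*ₚ d zero    = ≋-sym (-ₚ‿inverseʳ 1ₚ)
geometric-*ₚ d (suc c) = ≋-trans (unfold (X^ d) (geometric d c))
  (≋-trans (+ₚ-cong (≋-refl {1ₚ -ₚ X^ d}) (*ₚ-congˡ (X^ d) (geometric-*ₚ d c)))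
    (≋-trans (telescope (X^ d) (X^ (c * d))) (+ₚ-cong (≋-refl {1ₚ}) (-ₚ‿cong (X^-+ d (c * d))))))
  where
  unfold : ∀ x g → (1ₚ +ₚ x *ₚ g) *ₚ (1ₚ -ₚ x) ≋ (1ₚ -ₚ x) +ₚ x *ₚ (g *ₚ (1ₚ -ₚ x))
  unfold = solve 2 (λ x g → (Κ 1ₚ ⊕ x ⊗ g) ⊗ (Κ 1ₚ ⊕ ⊝ x) ⊜ ((Κ 1ₚ ⊕ ⊝ x) ⊕ x ⊗ (g ⊗ (Κ 1ₚ ⊕ ⊝ x)))) ≋-refl
  telescope : ∀ x y → (1ₚ -ₚ x) +ₚ x *ₚ (1ₚ -ₚ y) ≋ 1ₚ -ₚ x *ₚ y
  telescope = solve 2 (λ x y → (Κ 1ₚ ⊕ ⊝ x) ⊕ x ⊗ (Κ 1ₚ ⊕ ⊝ y) ⊜ (Κ 1ₚ ⊕ ⊝ (x ⊗ y))) ≋-refl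

coeff₀-1-X^ : ∀ M → .{{ℕ.NonZero M}} → coeff (1ₚ -ₚ X^ M) 0 ≡ + 1
coeff₀-1-X^ (suc M) = refl

coeff₀-denP : ∀ {m} (q : Fin (suc m) → ℕ) → (∀ k → ℕ.NonZero (q k)) → coeff (denP q) 0 ≡ + 1
coeff₀-denP q q≢0 = coeff₀-∏ₚ (λ a → 1ₚ -ₚ X^ (M₁ q a)) λ a → coeff₀-1-X^ (M₁ q a) {{M₁-nonZero q q≢0 a}}

coeff₀-denP-*ₚ : ∀ {m} (q : Fin (suc m) → ℕ) → (∀ k → ℕ.NonZero (q k)) →
                 ∀ a b → coeff (denP q *ₚ (1ₚ -ₚ X^ (M₂ q a b))) 0 ≡ + 1
coeff₀-denP-*ₚ q q≢0 a b = trans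
  (coeff₀-*ₚ-unitʳ (1ₚ -ₚ X^ (M₂ q a b)) (denP q) (coeff₀-1-X^ (M₂ q a b) {{M₂-nonZero q q≢0 a b}}))
  (coeff₀-denP q q≢0)

two-term-representation : ∀ K P E Sᵢ Πᵢ Sⱼ Πⱼ u v G₁ G₂ a b n l t g →
  K *ₚ P ≋ (1ₚ -ₚ l) *ₚ E → K *ₚ (Sᵢ *ₚ Πᵢ) ≋ u *ₚ E → K *ₚ (Sⱼ *ₚ Πⱼ) ≋ v *ₚ E →
  G₁ *ₚ u ≋ 1ₚ -ₚ a → G₂ *ₚ v ≋ n -ₚ b → a *ₚ b ≋ l *ₚ n → l *ₚ t ≋ a → g *ₚ v ≋ 1ₚ -ₚ t →
  K *ₚ P ≋ K *ₚ (G₁ *ₚ Sᵢ *ₚ Πᵢ +ₚ a *ₚ G₂ *ₚ Sⱼ *ₚ Πⱼ +ₚ Sⱼ *ₚ Πⱼ *ₚ l *ₚ g *ₚ (n -ₚ 1ₚ))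
two-term-representation K P E Sᵢ Πᵢ Sⱼ Πⱼ u v G₁ G₂ a b n l t g
  KP KSᵢ KSⱼ G₁u G₂v ab lt gv = ≋-sym (begin
  K *ₚ (G₁ *ₚ Sᵢ *ₚ Πᵢ +ₚ a *ₚ G₂ *ₚ Sⱼ *ₚ Πⱼ +ₚ Sⱼ *ₚ Πⱼ *ₚ l *ₚ g *ₚ (n -ₚ 1ₚ))
    ≈⟨ expand K G₁ Sᵢ Πᵢ a G₂ Sⱼ Πⱼ l g n ⟩
  G₁ *ₚ (K *ₚ (Sᵢ *ₚ Πᵢ)) +ₚ a *ₚ G₂ *ₚ (K *ₚ (Sⱼ *ₚ Πⱼ)) +ₚ l *ₚ g *ₚ (K *ₚ (Sⱼ *ₚ Πⱼ)) *ₚ (n -ₚ 1ₚ)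
    ≈⟨ +ₚ-cong (+ₚ-cong (*ₚ-congˡ G₁ KSᵢ) (*ₚ-congˡ (a *ₚ G₂) KSⱼ))
               (*ₚ-congʳ (n -ₚ 1ₚ) (*ₚ-congˡ (l *ₚ g) KSⱼ)) ⟩
  G₁ *ₚ (u *ₚ E) +ₚ a *ₚ G₂ *ₚ (v *ₚ E) +ₚ l *ₚ g *ₚ (v *ₚ E) *ₚ (n -ₚ 1ₚ)
    ≈⟨ regroup G₁ u E a G₂ v l g n ⟩
  (G₁ *ₚ u) *ₚ E +ₚ a *ₚ (G₂ *ₚ v) *ₚ E +ₚ l *ₚ (g *ₚ v) *ₚ E *ₚ (n -ₚ 1ₚ)
    ≈⟨ +ₚ-cong (+ₚ-cong (*ₚ-congʳ E G₁u) (*ₚ-congʳ E (*ₚ-congˡ a G₂v)))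
               (*ₚ-congʳ (n -ₚ 1ₚ) (*ₚ-congʳ E (*ₚ-congˡ l gv))) ⟩
  (1ₚ -ₚ a) *ₚ E +ₚ a *ₚ (n -ₚ b) *ₚ E +ₚ l *ₚ (1ₚ -ₚ t) *ₚ E *ₚ (n -ₚ 1ₚ)
    ≈⟨ collect a b n l t E ⟩
  ((1ₚ -ₚ a) +ₚ a *ₚ n -ₚ a *ₚ b +ₚ (l -ₚ l *ₚ t) *ₚ (n -ₚ 1ₚ)) *ₚ E
    ≈⟨ *ₚ-congʳ E (+ₚ-cong (+ₚ-cong (≋-refl {(1ₚ -ₚ a) +ₚ a *ₚ n}) (-ₚ‿cong ab))
                           (*ₚ-congʳ (n -ₚ 1ₚ) (+ₚ-cong (≋-refl {l}) (-ₚ‿cong lt)))) ⟩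
  ((1ₚ -ₚ a) +ₚ a *ₚ n -ₚ l *ₚ n +ₚ (l -ₚ a) *ₚ (n -ₚ 1ₚ)) *ₚ E
    ≈⟨ telescope a n l E ⟩
  (1ₚ -ₚ l) *ₚ E
    ≈⟨ KP ⟨
  K *ₚ P ∎)
  where
  open ≋-Reasoning
  expand : ∀ K G₁ Sᵢ Πᵢ a G₂ Sⱼ Πⱼ l g n →
    K *ₚ (G₁ *ₚ Sᵢ *ₚ Πᵢ +ₚ a *ₚ G₂ *ₚ Sⱼ *ₚ Πⱼ +ₚ Sⱼ *ₚ Πⱼ *ₚ l *ₚ g *ₚ (n -ₚ 1ₚ)) ≋
    G₁ *ₚ (K *ₚ (Sᵢ *ₚ Πᵢ)) +ₚ a *ₚ G₂ *ₚ (K *ₚ (Sⱼ *ₚ Πⱼ)) +ₚ l *ₚ g *ₚ (K *ₚ (Sⱼ *ₚ Πⱼ)) *ₚ (n -ₚ 1ₚ)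
  expand = solve 11 (λ K G₁ Sᵢ Πᵢ a G₂ Sⱼ Πⱼ l g n →
    K ⊗ (G₁ ⊗ Sᵢ ⊗ Πᵢ ⊕ a ⊗ G₂ ⊗ Sⱼ ⊗ Πⱼ ⊕ Sⱼ ⊗ Πⱼ ⊗ l ⊗ g ⊗ (n ⊕ ⊝ Κ 1ₚ)) ⊜
    (G₁ ⊗ (K ⊗ (Sᵢ ⊗ Πᵢ)) ⊕ a ⊗ G₂ ⊗ (K ⊗ (Sⱼ ⊗ Πⱼ)) ⊕ l ⊗ g ⊗ (K ⊗ (Sⱼ ⊗ Πⱼ)) ⊗ (n ⊕ ⊝ Κ 1ₚ))) ≋-refl
  regroup : ∀ G₁ u E a G₂ v l g n →
    G₁ *ₚ (u *ₚ E) +ₚ a *ₚ G₂ *ₚ (v *ₚ E) +ₚ l *ₚ g *ₚ (v *ₚ E) *ₚ (n -ₚ 1ₚ) ≋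
    (G₁ *ₚ u) *ₚ E +ₚ a *ₚ (G₂ *ₚ v) *ₚ E +ₚ l *ₚ (g *ₚ v) *ₚ E *ₚ (n -ₚ 1ₚ)
  regroup = solve 9 (λ G₁ u E a G₂ v l g n →
    (G₁ ⊗ (u ⊗ E) ⊕ a ⊗ G₂ ⊗ (v ⊗ E) ⊕ l ⊗ g ⊗ (v ⊗ E) ⊗ (n ⊕ ⊝ Κ 1ₚ)) ⊜
    ((G₁ ⊗ u) ⊗ E ⊕ a ⊗ (G₂ ⊗ v) ⊗ E ⊕ l ⊗ (g ⊗ v) ⊗ E ⊗ (n ⊕ ⊝ Κ 1ₚ))) ≋-refl
  collect : ∀ a b n l t E →
    (1ₚ -ₚ a) *ₚ E +ₚ a *ₚ (n -ₚ b) *ₚ E +ₚ l *ₚ (1ₚ -ₚ t) *ₚ E *ₚ (n -ₚ 1ₚ) ≋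
    ((1ₚ -ₚ a) +ₚ a *ₚ n -ₚ a *ₚ b +ₚ (l -ₚ l *ₚ t) *ₚ (n -ₚ 1ₚ)) *ₚ E
  collect = solve 6 (λ a b n l t E →
    ((Κ 1ₚ ⊕ ⊝ a) ⊗ E ⊕ a ⊗ (n ⊕ ⊝ b) ⊗ E ⊕ l ⊗ (Κ 1ₚ ⊕ ⊝ t) ⊗ E ⊗ (n ⊕ ⊝ Κ 1ₚ)) ⊜
    (((Κ 1ₚ ⊕ ⊝ a) ⊕ a ⊗ n ⊕ ⊝ (a ⊗ b) ⊕ (l ⊕ ⊝ (l ⊗ t)) ⊗ (n ⊕ ⊝ Κ 1ₚ)) ⊗ E)) ≋-refl
  telescope : ∀ a n l E →
    ((1ₚ -ₚ a) +ₚ a *ₚ n -ₚ l *ₚ n +ₚ (l -ₚ a) *ₚ (n -ₚ 1ₚ)) *ₚ E ≋ (1ₚ -ₚ l) *ₚ E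
  telescope = solve 4 (λ a n l E →
    ((Κ 1ₚ ⊕ ⊝ a) ⊕ a ⊗ n ⊕ ⊝ (l ⊗ n) ⊕ (l ⊕ ⊝ a) ⊗ (n ⊕ ⊝ Κ 1ₚ)) ⊗ E ⊜ ((Κ 1ₚ ⊕ ⊝ l) ⊗ E)) ≋-refl

module _ {m} .{{m>1 : ℕ.NonTrivial m}} where

  private instance
    m≢0 : ℕ.NonZero m
    m≢0 = ℕ.nonTrivial⇒nonZero m

  CongMod-1⇒%≡1 : ∀ x → CongMod m x 1 → x % m ≡ 1
  CongMod-1⇒%≡1 zero    m∣1            = contradiction (∣1⇒≡1 m∣1) (ℕP.>⇒≢ (ℕ.nonTrivial⇒n>1 m))
  CongMod-1⇒%≡1 (suc x) (divides c refl) =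
    trans ([m+kn]%n≡m%n 1 c m) (m<n⇒m%n≡m (ℕ.nonTrivial⇒n>1 m))

  %≡1⇒≡1+ : ∀ x → x % m ≡ 1 → x ≡ suc (x / m * m)
  %≡1⇒≡1+ x x%m≡1 = trans (m≡m%n+[m/n]*n x m) (cong (_+ x / m * m) x%m≡1)

  CongMod-1⇒≡1+ : ∀ x → CongMod m x 1 → x ≡ suc (x / m * m)
  CongMod-1⇒≡1+ x x≡1 = %≡1⇒≡1+ x (CongMod-1⇒%≡1 x x≡1)

  %≡1⇒CongMod-1 : ∀ x → x % m ≡ 1 → CongMod m x 1
  %≡1⇒CongMod-1 x x%m≡1 = subst (λ y → CongMod m y 1) (sym (%≡1⇒≡1+ x x%m≡1)) (divides (x / m) refl)

  -- A smaller solution e ∸ m would contradict minimality.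
  IsLeastSol⇒< : ∀ {b e} → IsLeastSol m 1 b e → e < m
  IsLeastSol⇒< {b} {e} (e*b≡1 , least) with e <? m
  ... | yes e<m = e<m
  ... | no  e≮m = contradiction (%≡1⇒CongMod-1 (k * b) k*b%m≡1) (least k k<e)
    where
    k : ℕ
    k = e ∸ m
    k+m≡e : k + m ≡ e
    k+m≡e = ℕP.m∸n+n≡m (ℕP.≮⇒≥ e≮m)
    k<e : k < e
    k<e = subst (k <_) k+m≡e (ℕP.m<m+n k (ℕ.>-nonZero⁻¹ m))
    k*b%m≡1 : k * b % m ≡ 1
    k*b%m≡1 = begin
      k * b % m             ≡⟨ [m+kn]%n≡m%n (k * b) b m ⟨
      (k * b + b * m) % m   ≡⟨ cong (λ x → (k * b + x) % m) (ℕP.*-comm b m) ⟩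
      (k * b + m * b) % m   ≡⟨ cong (_% m) (ℕP.*-distribʳ-+ b k m) ⟨
      (k + m) * b % m       ≡⟨ cong (λ x → x * b % m) k+m≡e ⟩
      e * b % m             ≡⟨ CongMod-1⇒%≡1 (e * b) e*b≡1 ⟩
      1                     ∎
      where open ≡-Reasoning

∣∧0<∧<2*⇒≡ : ∀ {p n} → p ∣ n → 0 < n → n < p + p → n ≡ p
∣∧0<∧<2*⇒≡ (divides zero          refl) ()
∣∧0<∧<2*⇒≡ {p} (divides (suc zero) refl) _ _ = ℕP.+-identityʳ p
∣∧0<∧<2*⇒≡ {p} (divides (suc (suc s)) refl) _ n<2p =
  contradiction (ℕP.+-monoʳ-≤ p (ℕP.m≤m+n p (s * p))) (ℕP.<⇒≱ n<2p)

least-inverses-sum : ∀ {p q e e′} → Prime p → Prime q → p ≢ q →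
                    IsLeastSol p 1 q e → IsLeastSol q 1 p e′ → e * q + e′ * p ≡ suc (p * q)
least-inverses-sum {p} {q} {e} {e′} p-prime q-prime p≢q Lp Lq = begin
  e * q + e′ * p        ≡⟨ cong (λ x → e * q + x) e′p≡ ⟩
  e * q + suc (d * q)   ≡⟨ ℕP.+-suc (e * q) (d * q) ⟩
  suc (e * q + d * q)   ≡⟨ cong suc (ℕP.*-distribʳ-+ q e d) ⟨
  suc ((e + d) * q)     ≡⟨ cong (λ x → suc (x * q)) e+d≡p ⟩
  suc (p * q)           ∎
  where
  open ≡-Reasoning
  instance
    p>1 : ℕ.NonTrivial p
    p>1 = prime⇒nonTrivial p-prime
    q>1 : ℕ.NonTrivial q
    q>1 = prime⇒nonTrivial q-prime
    p≢0 : ℕ.NonZero p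
    p≢0 = ℕ.nonTrivial⇒nonZero p
    q≢0 : ℕ.NonZero q
    q≢0 = ℕ.nonTrivial⇒nonZero q
  c d : ℕ
  c = e * q / p
  d = e′ * p / q
  eq≡ : e * q ≡ suc (c * p)
  eq≡ = CongMod-1⇒≡1+ (e * q) (proj₁ Lp)
  e′p≡ : e′ * p ≡ suc (d * q)
  e′p≡ = CongMod-1⇒≡1+ (e′ * p) (proj₁ Lq)
  d<p : d < p
  d<p = ℕP.*-cancelʳ-< q d p (ℕP.<-trans
    (subst (d * q <_) (sym e′p≡) (ℕP.n<1+n (d * q)))
    (subst (e′ * p <_) (ℕP.*-comm q p) (ℕP.*-monoˡ-< p (IsLeastSol⇒< Lq))))
  p∣[e+d]q : p ∣ (e + d) * q
  p∣[e+d]q = divides (c + e′) (ℕP.suc-injective (begin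
    suc ((e + d) * q)      ≡⟨ cong suc (ℕP.*-distribʳ-+ q e d) ⟩
    suc (e * q + d * q)    ≡⟨ ℕP.+-suc (e * q) (d * q) ⟨
    e * q + suc (d * q)    ≡⟨ cong (λ x → e * q + x) e′p≡ ⟨
    e * q + e′ * p         ≡⟨ cong (_+ e′ * p) eq≡ ⟩
    suc (c * p + e′ * p)   ≡⟨ cong suc (ℕP.*-distribʳ-+ p c e′) ⟨
    suc ((c + e′) * p)     ∎))
  p∣e+d : p ∣ e + d
  p∣e+d with euclidsLemma (e + d) q p-prime p∣[e+d]q
  ... | inj₁ p∣e+d = p∣e+d
  ... | inj₂ p∣q with prime⇒irreducible q-prime p∣q
  ...   | inj₁ p≡1 = contradiction p≡1 (ℕP.>⇒≢ (ℕ.nonTrivial⇒n>1 p))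
  ...   | inj₂ p≡q = contradiction p≡q p≢q
  0<e : 0 < e
  0<e = ℕP.n≢0⇒n>0 λ e≡0 → ℕP.0≢1+n (trans (cong (_* q) (sym e≡0)) eq≡)
  e+d≡p : e + d ≡ p
  e+d≡p = ∣∧0<∧<2*⇒≡ p∣e+d (ℕP.<-≤-trans 0<e (ℕP.m≤m+n e d)) (ℕP.+-mono-< (IsLeastSol⇒< Lp) d<p)

exponent-identities : ∀ pᵢ pⱼ eᵢ eⱼ c L → eⱼ * pⱼ ≡ suc (c * pᵢ) → eⱼ * pⱼ + eᵢ * pᵢ ≡ suc (pᵢ * pⱼ) →
  L + c * (pᵢ * L) ≡ eⱼ * (pⱼ * L) × eⱼ * (pⱼ * L) + eᵢ * (pᵢ * L) ≡ L + pᵢ * (pⱼ * L)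
exponent-identities pᵢ pⱼ eᵢ eⱼ c L eⱼpⱼ≡ sum≡ =
  (begin
    L + c * (pᵢ * L)          ≡⟨ expand₁ L c pᵢ ⟩
    suc (c * pᵢ) * L          ≡⟨ cong (_* L) eⱼpⱼ≡ ⟨
    eⱼ * pⱼ * L               ≡⟨ ℕP.*-assoc eⱼ pⱼ L ⟩
    eⱼ * (pⱼ * L)             ∎) ,
  (begin
    eⱼ * (pⱼ * L) + eᵢ * (pᵢ * L) ≡⟨ factor L pᵢ pⱼ eᵢ eⱼ ⟩
    (eⱼ * pⱼ + eᵢ * pᵢ) * L       ≡⟨ cong (_* L) sum≡ ⟩
    suc (pᵢ * pⱼ) * L             ≡⟨ expand₂ L pᵢ pⱼ ⟩
    L + pᵢ * (pⱼ * L)             ∎)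
  where
  open ≡-Reasoning
  expand₁ : ∀ L c pᵢ → L + c * (pᵢ * L) ≡ suc (c * pᵢ) * L
  expand₁ = solve-∀
  factor : ∀ L pᵢ pⱼ eᵢ eⱼ → eⱼ * (pⱼ * L) + eᵢ * (pᵢ * L) ≡ (eⱼ * pⱼ + eᵢ * pᵢ) * L
  factor = solve-∀
  expand₂ : ∀ L pᵢ pⱼ → suc (pᵢ * pⱼ) * L ≡ L + pᵢ * (pⱼ * L)
  expand₂ = solve-∀

monomial-relations : ∀ {m} (p : Fin (suc m) → ℕ) → (∀ k → Prime (p k)) → Injective _≡_ _≡_ p →
  ∀ {i j} → i ≢ j → ∀ {eᵢ eⱼ} → IsLeastSol (p i) 1 (p j) eⱼ → IsLeastSol (p j) 1 (p i) eᵢ →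
  ∃[ c ] X^ (M₂ p i j) *ₚ X^ (c * M₁ p j) ≋ X^ (eⱼ * M₁ p i)
       × X^ (eⱼ * M₁ p i) *ₚ X^ (eᵢ * M₁ p j) ≋ X^ (M₂ p i j) *ₚ X^ (Mof p)
monomial-relations p p-prime p-injective {i} {j} i≢j {eᵢ} {eⱼ} Lⱼ Lᵢ = c ,
  ≋-trans (X^-+ L (c * M₁ p j)) (≡⇒≋ (cong X^_ (begin
    L + c * M₁ p j                  ≡⟨ cong (λ x → L + c * x) Nⱼ≡ ⟩
    L + c * (p i * L)               ≡⟨ proj₁ relations ⟩
    eⱼ * (p j * L)                  ≡⟨ cong (eⱼ *_) Nᵢ≡ ⟨
    eⱼ * M₁ p i                     ∎))) ,
  ≋-trans (X^-+ (eⱼ * M₁ p i) (eᵢ * M₁ p j)) (≋-trans (≡⇒≋ (cong X^_ (begin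
    eⱼ * M₁ p i + eᵢ * M₁ p j       ≡⟨ cong₂ (λ x y → eⱼ * x + eᵢ * y) Nᵢ≡ Nⱼ≡ ⟩
    eⱼ * (p j * L) + eᵢ * (p i * L) ≡⟨ proj₂ relations ⟩
    L + p i * (p j * L)             ≡⟨ cong (λ x → L + x) N≡ ⟨
    L + Mof p                       ∎))) (≋-sym (X^-+ L (Mof p))))
  where
  open ≡-Reasoning
  instance
    pᵢ≢0 : ℕ.NonZero (p i)
    pᵢ≢0 = ℕ.nonTrivial⇒nonZero (p i) {{prime⇒nonTrivial (p-prime i)}}
  L c : ℕ
  L = M₂ p i j
  c = eⱼ * p j / p i
  Nᵢ≡ : M₁ p i ≡ p j * L
  Nᵢ≡ = M₁≡*M₂ p (i≢j ∘ sym)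
  Nⱼ≡ : M₁ p j ≡ p i * L
  Nⱼ≡ = trans (M₁≡*M₂ p i≢j) (cong (p i *_) (M₂-comm p j i))
  N≡ : Mof p ≡ p i * (p j * L)
  N≡ = trans (Mof-removeAt p i) (cong (p i *_) (trans (sym (M₁-self p i)) Nᵢ≡))
  relations : L + c * (p i * L) ≡ eⱼ * (p j * L) × eⱼ * (p j * L) + eᵢ * (p i * L) ≡ L + p i * (p j * L)
  relations = exponent-identities (p i) (p j) eᵢ eⱼ c L
    (CongMod-1⇒≡1+ {{prime⇒nonTrivial (p-prime i)}} (eⱼ * p j) (proj₁ Lⱼ))
    (least-inverses-sum (p-prime i) (p-prime j) (i≢j ∘ p-injective) Lⱼ Lᵢ)

mainTheorem16 : (m : ℕ) → 1 ≤ m →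
    (p : Fin (suc m) → ℕ) → (∀ k → Prime (p k)) → Injective _≡_ _≡_ p →
    (i j : Fin (suc m)) → i ≢ j →
    (PN : Poly) → IsP p PN →
    (PNi : Poly) → IsP (removeAt p i) PNi →
    (PNj : Poly) → IsP (removeAt p j) PNj →
    (ej : ℕ) → IsLeastSol (p i) 1 (p j) ej →
    (ei : ℕ) → IsLeastSol (p j) 1 (p i) ei →
    (G1 : Poly) → G1 *ₚ (1ₚ -ₚ X^ (M₁ p i)) ≈ₚ 1ₚ -ₚ X^ (ej * M₁ p i) →
    (G2 : Poly) → G2 *ₚ (1ₚ -ₚ X^ (M₁ p j)) ≈ₚ X^ (Mof p) -ₚ X^ (ei * M₁ p j) →
    CongModXN-1 (Mof p) PN
      (G1 *ₚ subX^ (p i) PNi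
          *ₚ ∏ₚ (λ k → if ⌊ k ≟ᶠ i ⌋ ∨ ⌊ k ≟ᶠ j ⌋ then 1ₚ else 1ₚ -ₚ X^ (M₂ p i k))
       +ₚ X^ (ej * M₁ p i) *ₚ G2 *ₚ subX^ (p j) PNj
          *ₚ ∏ₚ (λ k → if ⌊ k ≟ᶠ i ⌋ ∨ ⌊ k ≟ᶠ j ⌋ then 1ₚ else 1ₚ -ₚ X^ (M₂ p j k)))
mainTheorem16 m _ p p-prime p-injective i j i≢j PN isP PNi isPᵢ PNj isPⱼ eⱼ Lⱼ eᵢ Lᵢ G₁ G₁-eq G₂ G₂-eq =
  h , coeff-≡ representation
  where
  L Nᵢ Nⱼ N c : ℕ
  L = M₂ p i j
  Nᵢ = M₁ p i
  Nⱼ = M₁ p j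
  N = Mof p
  relations : ∃[ c ] X^ L *ₚ X^ (c * Nⱼ) ≋ X^ (eⱼ * Nᵢ) × X^ (eⱼ * Nᵢ) *ₚ X^ (eᵢ * Nⱼ) ≋ X^ L *ₚ X^ N
  relations = monomial-relations p p-prime p-injective i≢j Lⱼ Lᵢ
  c = proj₁ relations
  Sᵢ Sⱼ Πᵢ Πⱼ h : Poly
  Sᵢ = subX^ (p i) PNi
  Sⱼ = subX^ (p j) PNj
  Πᵢ = cofactor p i i j
  Πⱼ = cofactor p j i j
  h = Sⱼ *ₚ Πⱼ *ₚ X^ L *ₚ geometric Nⱼ c
  p≢0 : ∀ k → ℕ.NonZero (p k)
  p≢0 k = ℕ.nonTrivial⇒nonZero (p k) {{prime⇒nonTrivial (p-prime k)}}
  representation : PN ≋ G₁ *ₚ Sᵢ *ₚ Πᵢ +ₚ X^ (eⱼ * Nᵢ) *ₚ G₂ *ₚ Sⱼ *ₚ Πⱼ +ₚ h *ₚ (X^ N -ₚ 1ₚ)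
  representation = *ₚ-cancelˡ (denP p *ₚ (1ₚ -ₚ X^ L)) (coeff₀-denP-*ₚ p p≢0 i j)
    (two-term-representation (denP p *ₚ (1ₚ -ₚ X^ L)) PN (numP p) Sᵢ Πᵢ Sⱼ Πⱼ (1ₚ -ₚ X^ Nᵢ) (1ₚ -ₚ X^ Nⱼ) G₁ G₂
      (X^ (eⱼ * Nᵢ)) (X^ (eᵢ * Nⱼ)) (X^ N) (X^ L) (X^ (c * Nⱼ)) (geometric Nⱼ c)
      (IsP-*ₚ p (1ₚ -ₚ X^ L) PN isP)
      (liftedP-identity p (i≢j ∘ sym) PNi isPᵢ) (liftedP-identity′ p i≢j PNj isPⱼ)
      (mk≋ G₁-eq) (mk≋ G₂-eq) (proj₂ (proj₂ relations)) (proj₁ (proj₂ relations)) (geometric-*ₚ Nⱼ c))
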